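{- In the globular type theory, every judgment (of the form $\Gamma\vdash$, $\Gamma\vdash A$, $\Gamma\vdash t:A$ or $\Delta\vdash\sigma:\Gamma$) has at most one derivation.
   Context: Globular type theory: fix a countably infinite set of variables; terms are variables; types are $\star$ and $\mathrm{Hom}_A(t,u)$ for a type $A$ and terms $t,u$; contexts are lists $x_1:A_1,\dots,x_n:A_n$ (empty: $\emptyset$); substitutions are lists $\langle t_1,\dots,t_n\rangle$ (empty: $\langle\rangle$). Free variables: $FV(x)=\{x\}$, $FV(\star)=\emptyset$, $FV(\mathrm{Hom}_A(t,u))=FV(A)\cup FV(t)\cup FV(u)$, $FV(\emptyset)=\emptyset$, $FV(\Gamma,x:A)=FV(\Gamma)\cup\{x\}\cup FV(A)$. For $\Gamma=(x_i:A_i)_{i\le n}$ and $\sigma=\langle t_1,\dots,t_n\rangle$, $A[\sigma/\Gamma]$ replaces each $x_i$ by $t_i$. The derivation rules are: from $\Gamma\vdash$ infer $\Gamma\vdash\star$; from $\Gamma\vdash t:A$, $\Gamma\vdash u:A$ infer $\Gamma\vdash\mathrm{Hom}_A(t,u)$; from $\Gamma,x:A\vdash$ infer $\Gamma,x:A\vdash x:A$; from $\Gamma\vdash t:B$ infer $\Gamma,x:A\vdash t:B$ if $x\notin FV(t)\cup FV(B)$; $\emptyset\vdash$; from $\Gamma\vdash A$ infer $\Gamma,x:A\vdash$ if $x\notin FV(\Gamma)$; $\Gamma\vdash\langle\rangle:\emptyset$; from $\Delta\vdash\sigma:\Gamma$, $\Gamma\vdash A$, $\Delta\vdash t:A[\sigma/\Gamma]$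 infer $\Delta\vdash\langle\sigma,t\rangle:(\Gamma,x:A)$. -}

module Defs where

open import Data.Nat using (ℕ; _≡ᵇ_)
open import Data.Bool using (Bool; true; false; not; _∨_; if_then_else_)
open import Data.Product using (_×_; _,_)
open import Data.List using (List; []; _∷_; _++_)

Var : Set
Var = ℕ

data Tm : Set where
  var : Var → Tm

data Ty : Set where
  ⋆   : Ty
  Hom : Ty → Tm → Tm → Ty

data Ctx : Set where
  ∅     : Ctx
  _,_∶_ : Ctx → Var → Ty → Ctx

data Sub : Set where
  ⟨⟩    : Sub
  ⟨_,_⟩ : Sub → Tm → Sub

FVTm : Tm → List Var
FVTm (var x) = x ∷ []

FVTy : Ty → List Var
FVTy ⋆ = []
FVTy (Hom A t u) = FVTy A ++ FVTm t ++ FVTm u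

FVCtx : Ctx → List Var
FVCtx ∅ = []
FVCtx (Γ , x ∶ A) = FVCtx Γ ++ (x ∷ FVTy A)

-- Boolean membership test; side condition x ∉ S is  T (not (x ∈ᵇ S)).
_∈ᵇ_ : Var → List Var → Bool
x ∈ᵇ [] = false
x ∈ᵇ (y ∷ ys) = (x ≡ᵇ y) ∨ (x ∈ᵇ ys)

-- Simultaneous substitution A[σ/Γ]: each xᵢ is replaced by tᵢ
-- (the last binding wins; variables not in Γ are left unchanged;
--  in derivable judgments Γ has distinct variables and |σ| = |Γ|).
_[_/_]tm : Tm → Sub → Ctx → Tm
var x [ ⟨ σ , t ⟩ / Γ , y ∶ _ ]tm = if x ≡ᵇ y then t else (var x [ σ / Γ ]tm)
t [ _ / _ ]tm = t

_[_/_]ty : Ty → Sub → Ctx → Ty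
⋆ [ σ / Γ ]ty = ⋆
Hom A t u [ σ / Γ ]ty = Hom (A [ σ / Γ ]ty) (t [ σ / Γ ]tm) (u [ σ / Γ ]tm)

open import Data.Bool using (T)

infix 4 _⊢ _⊢ty_ _⊢_∶_ _⊢s_∶_
mutual
  data _⊢ : Ctx → Set where
    ec : ∅ ⊢
    cc : ∀ {Γ x A} → Γ ⊢ty A → T (not (x ∈ᵇ FVCtx Γ)) → (Γ , x ∶ A) ⊢

  data _⊢ty_ : Ctx → Ty → Set where
    ⋆-intro   : ∀ {Γ} → Γ ⊢ → Γ ⊢ty ⋆
    Hom-intro : ∀ {Γ A t u} → Γ ⊢ t ∶ A → Γ ⊢ u ∶ A → Γ ⊢ty Hom A t u

  data _⊢_∶_ : Ctx → Tm → Ty → Set where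
    var-rule : ∀ {Γ x A} → (Γ , x ∶ A) ⊢ → (Γ , x ∶ A) ⊢ var x ∶ A
    wk       : ∀ {Γ x A t B} → Γ ⊢ t ∶ B →
               T (not (x ∈ᵇ (FVTm t ++ FVTy B))) → (Γ , x ∶ A) ⊢ t ∶ B

  data _⊢s_∶_ : Ctx → Sub → Ctx → Set where
    es : ∀ {Δ} → Δ ⊢s ⟨⟩ ∶ ∅
    sc : ∀ {Δ σ Γ x A t} → Δ ⊢s σ ∶ Γ → Γ ⊢ty A → Δ ⊢ t ∶ (A [ σ / Γ ]ty) →
         Δ ⊢s ⟨ σ , t ⟩ ∶ (Γ , x ∶ A)

-- The rules are syntax-directed: the conclusion of a judgment determines the
-- last rule applied, with the sole exception of a term judgment Γ , x ∶ A ⊢ var x ∶ A,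
-- which might come from the variable rule or from weakening; weakening is excluded
-- there because its side condition would require x ∉ FV(var x).  Side conditions are
-- decided Booleans, whose proofs are unique, so induction on derivations concludes.
module Submission where

open import Defs
open import Data.Bool using (true; not; T)
open import Data.Bool.Properties using (T-irrelevant; T-∨)
open import Data.Empty using (⊥-elim)
open import Data.List using (List; _∷_)
open import Data.Nat.Properties using (≡⇒≡ᵇ)
open import Data.Product using (_×_; _,_)
open import Data.Sum using (inj₁)
open import Function.Bundles using (Equivalence)
open import Relation.Binary.PropositionalEquality using (_≡_; refl; cong; cong₂)
open import Relation.Nullary using (¬_)

∈ᵇ-head : ∀ x (ys : List Var) → T (x ∈ᵇ (x ∷ ys))
∈ᵇ-head x ys = Equivalence.from T-∨ (inj₁ (≡⇒≡ᵇ x x refl))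

T⇒¬T-not : ∀ {b} → T b → ¬ T (not b)
T⇒¬T-not {true} _ ()

∉ᵇ-head : ∀ x (ys : List Var) → ¬ T (not (x ∈ᵇ (x ∷ ys)))
∉ᵇ-head x ys = T⇒¬T-not (∈ᵇ-head x ys)

mutual
  ⊢-irrelevant : ∀ {Γ} (d d′ : Γ ⊢) → d ≡ d′
  ⊢-irrelevant ec ec = refl
  ⊢-irrelevant (cc a p) (cc a′ p′) = cong₂ cc (⊢ty-irrelevant a a′) (T-irrelevant p p′)

  ⊢ty-irrelevant : ∀ {Γ A} (d d′ : Γ ⊢ty A) → d ≡ d′
  ⊢ty-irrelevant (⋆-intro c) (⋆-intro c′) = cong ⋆-intro (⊢-irrelevant c c′)
  ⊢ty-irrelevant (Hom-intro t u) (Hom-intro t′ u′) =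
    cong₂ Hom-intro (⊢tm-irrelevant t t′) (⊢tm-irrelevant u u′)

  ⊢tm-irrelevant : ∀ {Γ t A} (d d′ : Γ ⊢ t ∶ A) → d ≡ d′
  ⊢tm-irrelevant (var-rule c) (var-rule c′) = cong var-rule (⊢-irrelevant c c′)
  ⊢tm-irrelevant (var-rule {x = x} {A = A} _) (wk _ fresh) = ⊥-elim (∉ᵇ-head x (FVTy A) fresh)
  ⊢tm-irrelevant (wk {x = x} {B = B} _ fresh) (var-rule _) = ⊥-elim (∉ᵇ-head x (FVTy B) fresh)
  ⊢tm-irrelevant (wk t p) (wk t′ p′) = cong₂ wk (⊢tm-irrelevant t t′) (T-irrelevant p p′)

  ⊢s-irrelevant : ∀ {Δ σ Γ} (d d′ : Δ ⊢s σ ∶ Γ) → d ≡ d′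
  ⊢s-irrelevant es es = refl
  ⊢s-irrelevant (sc s A t) (sc s′ A′ t′)
    with ⊢s-irrelevant s s′ | ⊢ty-irrelevant A A′ | ⊢tm-irrelevant t t′
  ... | refl | refl | refl = refl

mainTheorem16 : (∀ {Γ} (d d′ : Γ ⊢) → d ≡ d′)
                × (∀ {Γ A} (d d′ : Γ ⊢ty A) → d ≡ d′)
                × (∀ {Γ t A} (d d′ : Γ ⊢ t ∶ A) → d ≡ d′)
                × (∀ {Δ σ Γ} (d d′ : Δ ⊢s σ ∶ Γ) → d ≡ d′)
mainTheorem16 = ⊢-irrelevant , ⊢ty-irrelevant , ⊢tm-irrelevant , ⊢s-irrelevant
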